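{- Let $n$ be a nonnegative integer and $j$ an integer. There exists a partition of $n$ with BG-rank equal to $j$ if and only if $j+n$ is even and $j(2j-1)\le n$.
   Context: For a partition $\pi$, draw its Ferrers diagram and fill the cells with alternating $+1$ and $-1$ entries in chessboard fashion, with $+1$ in the cell at position $(1,1)$ (so the cell in row $r$, column $c$ gets $(-1)^{r+c}$). The sum of all these entries is the BG-rank of $\pi$. -}

module Defs where

open import Data.Nat using (ℕ; zero; suc; _+_; _≥_; _>_)
open import Data.Integer as ℤ using (ℤ; +_; -[1+_])
open import Data.List using (List; []; _∷_; upTo; map)
open import Data.Nat.ListAction using (sum)
open import Data.List.Relation.Unary.All using (All)
open import Data.List.Relation.Unary.Linked using (Linked)
open import Relation.Binary.PropositionalEquality using (_≡_)
open import Data.Product using (_×_)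

sign : ℕ → ℤ
sign zero = + 1
sign (suc zero) = -[1+ 0 ]
sign (suc (suc k)) = sign k

IsPartition : ℕ → List ℕ → Set
IsPartition n λs = Linked _≥_ λs × All (_> 0) λs × sum λs ≡ n

sumℤ : List ℤ → ℤ
sumℤ [] = + 0
sumℤ (x ∷ xs) = x ℤ.+ sumℤ xs

-- Sum of the chessboard entries (-1)^(r+c) over the cells (r,c), c = 1..len, of row r.
rowSum : ℕ → ℕ → ℤ
rowSum r len = sumℤ (map (λ c → sign (r + suc c)) (upTo len))

bgRankFrom : ℕ → List ℕ → ℤ
bgRankFrom r [] = + 0
bgRankFrom r (l ∷ ls) = rowSum r l ℤ.+ bgRankFrom (suc r) ls

bgRank : List ℕ → ℤ
bgRank = bgRankFrom 1

-- Adding a row of length x on top of a partition swaps the colours of the rows below,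
-- so bgRank (x ∷ λ) = [x odd] - bgRank λ. Reading λ from its last row upwards, this
-- recursion is tracked by an index h that moves down by one when the new row has the
-- parity of h and up by one otherwise; bgRank λ is then the BG-rank of the staircase
-- (h, h-1, ..., 1), namely -h/2 or (h+1)/2, and h(h+1)/2 = j(2j-1). As h never exceeds
-- the top row, n - h(h+1)/2 stays a nonnegative even number along the way, which gives
-- both conditions. Conversely, the staircase with its first row lengthened by an even
-- amount realises every admissible pair (n, j).
module Submission where

open import Defs
open import Data.Nat using (ℕ)
open import Data.Integer using (ℤ; +_; _+_; _*_; _-_; _≤_)
open import Data.Integer.Divisibility using (_∣_)
open import Data.List using (List)
open import Data.Product using (Σ; _×_)
open import Relation.Binary.PropositionalEquality using (_≡_)
open import Function.Bundles using (_⇔_)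

open import Data.Nat as ℕ using (zero; suc; _∸_; _≥_; _>_; z≤n; s≤s; parity)
import Data.Nat.Properties as ℕₚ
import Data.Nat.Divisibility as ℕ∣
open import Data.Nat.ListAction using (sum)
import Data.Nat.Tactic.RingSolver as ℕ-Solver
open import Data.Integer using (-_; -[1+_]; +≤+)
import Data.Integer.Properties as ℤₚ
import Data.Integer.Divisibility.Signed as Signed
import Data.Integer.Tactic.RingSolver as ℤ-Solver
open import Data.Parity.Base using (Parity; 0ℙ; 1ℙ; _⁻¹)
open import Data.Parity.Properties
  using (_≟_; ⁻¹-selfInverse; ⁻¹-injective; p≢p⁻¹; suc-homo-⁻¹)
open import Data.List using ([]; _∷_; map; applyUpTo)
open import Data.List.Properties using (map-applyUpTo)
open import Data.List.Relation.Unary.All using (All; []; _∷_)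
open import Data.List.Relation.Unary.Linked as Linked using (Linked; []; [-]; _∷_)
open import Data.Product using (_,_; ∃-syntax)
open import Data.Sum using (inj₁; inj₂)
open import Function using (id)
open import Function.Bundles using (mk⇔; module Equivalence)
open import Relation.Binary.PropositionalEquality
  using (refl; sym; trans; cong; cong₂; subst; _≢_; module ≡-Reasoning)
open import Relation.Nullary using (yes; no; contradiction)

parityToℤ : Parity → ℤ
parityToℤ 0ℙ = + 0
parityToℤ 1ℙ = + 1

sign-suc : ∀ k → sign (suc k) ≡ - sign k
sign-suc zero = refl
sign-suc (suc zero) = refl
sign-suc (suc (suc k)) = sign-suc k

sumℤ-map-neg : ∀ {A : Set} (f g : A → ℤ) → (∀ x → g x ≡ - f x) →
  ∀ xs → sumℤ (map g xs) ≡ - sumℤ (map f xs)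
sumℤ-map-neg f g g≡-f [] = refl
sumℤ-map-neg f g g≡-f (x ∷ xs) = trans
  (cong₂ _+_ (g≡-f x) (sumℤ-map-neg f g g≡-f xs))
  (sym (ℤₚ.neg-distrib-+ (f x) (sumℤ (map f xs))))

rowSum-suc : ∀ r l → rowSum (suc r) l ≡ - rowSum r l
rowSum-suc r l = sumℤ-map-neg _ _ (λ c → sign-suc (r ℕ.+ suc c)) (applyUpTo id l)

bgRankFrom-suc : ∀ r L → bgRankFrom (suc r) L ≡ - bgRankFrom r L
bgRankFrom-suc r [] = refl
bgRankFrom-suc r (l ∷ L) = trans
  (cong₂ _+_ (rowSum-suc r l) (bgRankFrom-suc (suc r) L))
  (sym (ℤₚ.neg-distrib-+ (rowSum r l) (bgRankFrom (suc r) L)))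

sumℤ-alternating : ∀ l → sumℤ (applyUpTo sign l) ≡ parityToℤ (parity l)
sumℤ-alternating zero = refl
sumℤ-alternating (suc zero) = refl
sumℤ-alternating (suc (suc l)) = begin
  + 1 + (-[1+ 0 ] + s) ≡⟨ sym (ℤₚ.+-assoc (+ 1) -[1+ 0 ] s) ⟩
  + 0 + s              ≡⟨ ℤₚ.+-identityˡ s ⟩
  s                    ≡⟨ sumℤ-alternating l ⟩
  parityToℤ (parity l) ∎
  where
  open ≡-Reasoning
  s = sumℤ (applyUpTo sign l)

rowSum-one : ∀ l → rowSum 1 l ≡ parityToℤ (parity l)
rowSum-one l = trans (cong sumℤ (map-applyUpTo id _ l)) (sumℤ-alternating l)

bgRank-∷ : ∀ x L → bgRank (x ∷ L) ≡ parityToℤ (parity x) - bgRank L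
bgRank-∷ x L = cong₂ _+_ (rowSum-one x) (bgRankFrom-suc 1 L)

parity-suc : ∀ n → parity (suc n) ≡ parity n ⁻¹
parity-suc n = sym (⁻¹-selfInverse (suc-homo-⁻¹ n))

≢⇒≡⁻¹ : ∀ {p q : Parity} → p ≢ q → p ≡ q ⁻¹
≢⇒≡⁻¹ {0ℙ} {0ℙ} p≢q = contradiction refl p≢q
≢⇒≡⁻¹ {0ℙ} {1ℙ} _ = refl
≢⇒≡⁻¹ {1ℙ} {0ℙ} _ = refl
≢⇒≡⁻¹ {1ℙ} {1ℙ} p≢q = contradiction refl p≢q

parity-*2 : ∀ m → parity (m ℕ.* 2) ≡ 0ℙ
parity-*2 zero = refl
parity-*2 (suc m) = parity-*2 m

parity-+-*2 : ∀ k e → parity (k ℕ.+ e ℕ.* 2) ≡ parity k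
parity-+-*2 k e = trans (cong parity (ℕₚ.+-comm k (e ℕ.* 2))) (parity-*2+ e)
  where
  parity-*2+ : ∀ e → parity (e ℕ.* 2 ℕ.+ k) ≡ parity k
  parity-*2+ zero = refl
  parity-*2+ (suc e) = parity-*2+ e

infix 4 _≤₂_
_≤₂_ : ℕ → ℕ → Set
k ≤₂ n = ∃[ e ] n ≡ k ℕ.+ e ℕ.* 2

≤₂-refl : ∀ k → k ≤₂ k
≤₂-refl k = 0 , sym (ℕₚ.+-identityʳ k)

≤₂-trans : ∀ {a b c} → a ≤₂ b → b ≤₂ c → a ≤₂ c
≤₂-trans {a} (d , refl) (e , refl) = d ℕ.+ e , shift a d e
  where
  shift : ∀ a d e → a ℕ.+ d ℕ.* 2 ℕ.+ e ℕ.* 2 ≡ a ℕ.+ (d ℕ.+ e) ℕ.* 2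
  shift = ℕ-Solver.solve-∀

≤₂-+ : ∀ {a b c d} → a ≤₂ b → c ≤₂ d → a ℕ.+ c ≤₂ b ℕ.+ d
≤₂-+ {a} {c = c} (e , refl) (f , refl) = e ℕ.+ f , interchange a c e f
  where
  interchange : ∀ a c e f → a ℕ.+ e ℕ.* 2 ℕ.+ (c ℕ.+ f ℕ.* 2) ≡ a ℕ.+ c ℕ.+ (e ℕ.+ f) ℕ.* 2
  interchange = ℕ-Solver.solve-∀

≤₂⇒≤ : ∀ {k n} → k ≤₂ n → k ℕ.≤ n
≤₂⇒≤ {k} (e , refl) = ℕₚ.m≤m+n k (e ℕ.* 2)

even⇒0≤₂ : ∀ n → parity n ≡ 0ℙ → 0 ≤₂ n
even⇒0≤₂ zero _ = ≤₂-refl 0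
even⇒0≤₂ (suc zero) ()
even⇒0≤₂ (suc (suc n)) even with even⇒0≤₂ n even
... | e , refl = suc e , refl

sameParity⇒≤₂ : ∀ {y x} → y ℕ.≤ x → parity x ≡ parity y → y ≤₂ x
sameParity⇒≤₂ {zero} {x} _ eq = even⇒0≤₂ x eq
sameParity⇒≤₂ {suc y} {suc x} (s≤s y≤x) eq
  with sameParity⇒≤₂ y≤x (⁻¹-injective (trans (sym (parity-suc x)) (trans eq (parity-suc y))))
... | e , refl = e , refl

parity-≢⇒< : ∀ {y x} → y ℕ.≤ x → parity x ≢ parity y → suc y ℕ.≤ x
parity-≢⇒< y≤x x≢y with ℕₚ.m≤n⇒m<n∨m≡n y≤x
... | inj₁ y<x = y<x
... | inj₂ refl = contradiction refl x≢y

-- coreIndex λ is the h for which the 2-core of λ is the staircase (h, h-1, ..., 1).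
coreStep : ℕ → ℕ → ℕ
coreStep x h with parity x ≟ parity h
... | yes _ = h ∸ 1
... | no _ = suc h

coreIndex : List ℕ → ℕ
coreIndex [] = 0
coreIndex (x ∷ L) = coreStep x (coreIndex L)

coreStep-≡ : ∀ {x h} → parity x ≡ parity h → coreStep x h ≡ h ∸ 1
coreStep-≡ {x} {h} x≡h with parity x ≟ parity h
... | yes _ = refl
... | no x≢h = contradiction x≡h x≢h

coreStep-≢ : ∀ {x h} → parity x ≢ parity h → coreStep x h ≡ suc h
coreStep-≢ {x} {h} x≢h with parity x ≟ parity h
... | yes x≡h = contradiction x≡h x≢h
... | no _ = refl

staircaseRank : ℕ → ℤ
staircaseRank zero = + 0
staircaseRank (suc h) = parityToℤ (parity (suc h)) - staircaseRank h

staircaseRank-pred : ∀ h → staircaseRank (h ∸ 1) ≡ parityToℤ (parity h) - staircaseRank h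
staircaseRank-pred zero = refl
staircaseRank-pred (suc h) = cancel (parityToℤ (parity (suc h))) (staircaseRank h)
  where
  cancel : ∀ a z → z ≡ a - (a - z)
  cancel = ℤ-Solver.solve-∀

staircaseRank-coreStep : ∀ x h →
  staircaseRank (coreStep x h) ≡ parityToℤ (parity x) - staircaseRank h
staircaseRank-coreStep x h with parity x ≟ parity h
... | yes x≡h = trans (staircaseRank-pred h) (cong (λ p → parityToℤ p - staircaseRank h) (sym x≡h))
... | no x≢h = cong (λ p → parityToℤ p - staircaseRank h)
                    (trans (parity-suc h) (sym (≢⇒≡⁻¹ x≢h)))

bgRank≡staircaseRank-coreIndex : ∀ L → bgRank L ≡ staircaseRank (coreIndex L)
bgRank≡staircaseRank-coreIndex [] = refl
bgRank≡staircaseRank-coreIndex (x ∷ L) = begin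
  bgRank (x ∷ L)                             ≡⟨ bgRank-∷ x L ⟩
  parityToℤ (parity x) - bgRank L            ≡⟨ cong (λ r → parityToℤ (parity x) - r) rank-L ⟩
  parityToℤ (parity x) - staircaseRank h     ≡⟨ sym (staircaseRank-coreStep x h) ⟩
  staircaseRank (coreStep x h)               ∎
  where
  open ≡-Reasoning
  h = coreIndex L
  rank-L = bgRank≡staircaseRank-coreIndex L

triangular : ℕ → ℕ
triangular zero = 0
triangular (suc h) = suc h ℕ.+ triangular h

coreStep-≤ : ∀ {x h} → h ℕ.≤ x → coreStep x h ℕ.≤ x
coreStep-≤ {x} {h} h≤x with parity x ≟ parity h
... | yes _ = ℕₚ.≤-trans (ℕₚ.m∸n≤m h 1) h≤x
... | no x≢h = parity-≢⇒< h≤x x≢h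

triangular-pred≤₂ : ∀ h → triangular (h ∸ 1) ≤₂ h ℕ.+ triangular h
triangular-pred≤₂ zero = ≤₂-refl 0
triangular-pred≤₂ (suc k) = suc k , regroup k (triangular k)
  where
  regroup : ∀ k t → suc k ℕ.+ (suc k ℕ.+ t) ≡ t ℕ.+ suc k ℕ.* 2
  regroup = ℕ-Solver.solve-∀

triangular-coreStep : ∀ {x h s} → h ℕ.≤ x → triangular h ≤₂ s →
  triangular (coreStep x h) ≤₂ x ℕ.+ s
triangular-coreStep {x} {h} h≤x t≤₂s with parity x ≟ parity h
... | yes x≡h = ≤₂-trans (triangular-pred≤₂ h) (≤₂-+ (sameParity⇒≤₂ h≤x x≡h) t≤₂s)
... | no x≢h = ≤₂-+ (sameParity⇒≤₂ (parity-≢⇒< h≤x x≢h)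
                       (trans (≢⇒≡⁻¹ x≢h) (sym (parity-suc h)))) t≤₂s

coreIndex-≤ : ∀ {x} L → Linked _≥_ (x ∷ L) → coreIndex L ℕ.≤ x
coreIndex-≤ [] _ = z≤n
coreIndex-≤ (y ∷ L) (x≥y ∷ sorted) = ℕₚ.≤-trans (coreStep-≤ (coreIndex-≤ L sorted)) x≥y

triangular-coreIndex≤₂sum : ∀ L → Linked _≥_ L → triangular (coreIndex L) ≤₂ sum L
triangular-coreIndex≤₂sum [] _ = ≤₂-refl 0
triangular-coreIndex≤₂sum (x ∷ L) sorted =
  triangular-coreStep (coreIndex-≤ L sorted) (triangular-coreIndex≤₂sum L (Linked.tail sorted))

staircase : ℕ → List ℕ
staircase zero = []
staircase (suc k) = suc k ∷ staircase k

staircase-coreIndex : ∀ k → coreIndex (staircase k) ≡ k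
staircase-coreIndex zero = refl
staircase-coreIndex (suc k) rewrite staircase-coreIndex k =
  coreStep-≢ {suc k} (λ eq → p≢p⁻¹ (parity k) (trans (sym eq) (parity-suc k)))

staircase-sum : ∀ k → sum (staircase k) ≡ triangular k
staircase-sum zero = refl
staircase-sum (suc k) = cong (suc k ℕ.+_) (staircase-sum k)

staircase-positive : ∀ k → All (_> 0) (staircase k)
staircase-positive zero = []
staircase-positive (suc k) = s≤s z≤n ∷ staircase-positive k

staircase-sorted : ∀ {x} k → k ℕ.≤ x → Linked _≥_ (x ∷ staircase k)
staircase-sorted zero _ = [-]
staircase-sorted (suc k) k<x = k<x ∷ staircase-sorted k (ℕₚ.n≤1+n k)

partitionWithCoreIndex : ∀ h {n} → triangular h ≤₂ n →
  Σ (List ℕ) (λ L → IsPartition n L × coreIndex L ≡ h)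
partitionWithCoreIndex zero (zero , refl) = [] , ([] , [] , refl) , refl
partitionWithCoreIndex zero (suc e , refl) =
  suc e ℕ.* 2 ∷ [] ,
  ([-] , s≤s z≤n ∷ [] , ℕₚ.+-identityʳ _) ,
  coreStep-≡ {suc e ℕ.* 2} {0} (parity-*2 e)
partitionWithCoreIndex (suc k) (e , refl) =
  row ∷ staircase k ,
  (staircase-sorted k (ℕₚ.≤-trans (ℕₚ.n≤1+n k) (ℕₚ.m≤m+n (suc k) (e ℕ.* 2))) ,
   s≤s z≤n ∷ staircase-positive k ,
   trans (cong (row ℕ.+_) (staircase-sum k)) (regroup k (e ℕ.* 2) (triangular k))) ,
  trans (cong (coreStep row) (staircase-coreIndex k)) (coreStep-≢ {row} row≢k)
  where
  row = suc k ℕ.+ e ℕ.* 2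
  row≢k : parity row ≢ parity k
  row≢k eq = p≢p⁻¹ (parity k) (trans (sym eq) (trans (parity-+-*2 (suc k) e) (parity-suc k)))
  regroup : ∀ k f t → suc k ℕ.+ f ℕ.+ t ≡ suc k ℕ.+ t ℕ.+ f
  regroup = ℕ-Solver.solve-∀

data EvenOrOdd : ℕ → Set where
  even : ∀ m → EvenOrOdd (m ℕ.* 2)
  odd  : ∀ m → EvenOrOdd (suc (m ℕ.* 2))

evenOrOdd : ∀ h → EvenOrOdd h
evenOrOdd zero = even 0
evenOrOdd (suc h) with evenOrOdd h
... | even m = odd m
... | odd m = even (suc m)

staircaseRank-even : ∀ m → staircaseRank (m ℕ.* 2) ≡ - + m
staircaseRank-odd : ∀ m → staircaseRank (suc (m ℕ.* 2)) ≡ + 1 + + m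
staircaseRank-even zero = refl
staircaseRank-even (suc m) rewrite parity-*2 m | staircaseRank-odd m = ℤₚ.+-identityˡ _
staircaseRank-odd m rewrite parity-suc (m ℕ.* 2) | parity-*2 m | staircaseRank-even m =
  cong (_+_ (+ 1)) (ℤₚ.neg-involutive (+ m))

pos-2m+1 : ∀ m → + (m ℕ.* 2 ℕ.+ 1) ≡ + m * + 2 + + 1
pos-2m+1 m = trans (ℤₚ.pos-+ (m ℕ.* 2) 1) (cong (_+ + 1) (ℤₚ.pos-* m 2))

triangular-*2 : ∀ m → + triangular (m ℕ.* 2) ≡ + m * (+ m * + 2 + + 1)
triangular-*2 m = trans (cong +_ (closedForm m))
  (trans (ℤₚ.pos-* m _) (cong (_*_ (+ m)) (pos-2m+1 m)))
  where
  expand : ∀ m → suc (suc (m ℕ.* 2)) ℕ.+ (suc (m ℕ.* 2) ℕ.+ m ℕ.* (m ℕ.* 2 ℕ.+ 1))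
               ≡ suc m ℕ.* (suc m ℕ.* 2 ℕ.+ 1)
  expand = ℕ-Solver.solve-∀
  closedForm : ∀ m → triangular (m ℕ.* 2) ≡ m ℕ.* (m ℕ.* 2 ℕ.+ 1)
  closedForm zero = refl
  closedForm (suc m) rewrite closedForm m = expand m

triangular-1+*2 : ∀ m → + triangular (suc (m ℕ.* 2)) ≡ (+ 1 + + m) * (+ m * + 2 + + 1)
triangular-1+*2 m = begin
  + (suc (m ℕ.* 2) ℕ.+ triangular (m ℕ.* 2))  ≡⟨ ℤₚ.pos-+ (suc (m ℕ.* 2)) _ ⟩
  + suc (m ℕ.* 2) + + triangular (m ℕ.* 2)    ≡⟨ cong₂ _+_ pos-1+2m (triangular-*2 m) ⟩
  + m * + 2 + + 1 + + m * (+ m * + 2 + + 1)   ≡⟨ factor (+ m) ⟩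
  (+ 1 + + m) * (+ m * + 2 + + 1)             ∎
  where
  open ≡-Reasoning
  pos-1+2m : + suc (m ℕ.* 2) ≡ + m * + 2 + + 1
  pos-1+2m = trans (cong +_ (ℕₚ.+-comm 1 (m ℕ.* 2))) (pos-2m+1 m)
  factor : ∀ a → a * + 2 + + 1 + a * (a * + 2 + + 1) ≡ (+ 1 + a) * (a * + 2 + + 1)
  factor = ℤ-Solver.solve-∀

staircaseRank-triangular : ∀ h →
  staircaseRank h * (+ 2 * staircaseRank h - + 1) ≡ + triangular h
staircaseRank-triangular h with evenOrOdd h
... | even m = trans (cong (λ r → r * (+ 2 * r - + 1)) (staircaseRank-even m))
                     (trans (identity (+ m)) (sym (triangular-*2 m)))
  where
  identity : ∀ a → - a * (+ 2 * - a - + 1) ≡ a * (a * + 2 + + 1)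
  identity = ℤ-Solver.solve-∀
... | odd m = trans (cong (λ r → r * (+ 2 * r - + 1)) (staircaseRank-odd m))
                    (trans (identity (+ m)) (sym (triangular-1+*2 m)))
  where
  identity : ∀ a → (+ 1 + a) * (+ 2 * (+ 1 + a) - + 1) ≡ (+ 1 + a) * (a * + 2 + + 1)
  identity = ℤ-Solver.solve-∀

staircaseRank+triangular-even : ∀ h → + 2 Signed.∣ staircaseRank h + + triangular h
staircaseRank+triangular-even h with evenOrOdd h
... | even m = Signed.divides (+ m * + m)
  (trans (cong₂ _+_ (staircaseRank-even m) (triangular-*2 m)) (identity (+ m)))
  where
  identity : ∀ a → - a + a * (a * + 2 + + 1) ≡ a * a * + 2
  identity = ℤ-Solver.solve-∀
... | odd m = Signed.divides ((+ 1 + + m) * (+ 1 + + m))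
  (trans (cong₂ _+_ (staircaseRank-odd m) (triangular-1+*2 m)) (identity (+ m)))
  where
  identity : ∀ a → (+ 1 + a) + (+ 1 + a) * (a * + 2 + + 1) ≡ (+ 1 + a) * (+ 1 + a) * + 2
  identity = ℤ-Solver.solve-∀

≤₂-from-evenSums : ∀ j {t n} → t ℕ.≤ n →
  + 2 Signed.∣ j + + n → + 2 Signed.∣ j + + t → t ≤₂ n
≤₂-from-evenSums j {t} {n} t≤n 2∣j+n 2∣j+t =
  ℕ∣._∣_.quotient 2∣d , trans (sym t+d≡n) (cong (t ℕ.+_) (ℕ∣._∣_.equality 2∣d))
  where
  d = n ∸ t
  t+d≡n : t ℕ.+ d ≡ n
  t+d≡n = ℕₚ.m+[n∸m]≡n t≤n
  j+n≡j+t+d : j + + n ≡ j + + t + + d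
  j+n≡j+t+d = begin
    j + + n            ≡⟨ cong (λ k → j + + k) (sym t+d≡n) ⟩
    j + + (t ℕ.+ d)    ≡⟨ cong (_+_ j) (ℤₚ.pos-+ t d) ⟩
    j + (+ t + + d)    ≡⟨ sym (ℤₚ.+-assoc j (+ t) (+ d)) ⟩
    j + + t + + d      ∎
    where open ≡-Reasoning
  2∣d : 2 ℕ∣.∣ d
  2∣d = Signed.∣⇒∣ᵤ (Signed.∣m+n∣m⇒∣n (subst (+ 2 Signed.∣_) j+n≡j+t+d 2∣j+n) 2∣j+t)

RankCondition : ℕ → ℤ → Set
RankCondition n j = (+ 2 ∣ j + + n) × (j * (+ 2 * j - + 1) ≤ + n)

rankCondition⇔triangular≤₂ : ∀ h n → RankCondition n (staircaseRank h) ⇔ triangular h ≤₂ n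
rankCondition⇔triangular≤₂ h n = mk⇔ to from
  where
  j = staircaseRank h
  t = triangular h

  to : RankCondition n j → t ≤₂ n
  to (2∣j+n , bound) = ≤₂-from-evenSums j
    (ℤₚ.drop‿+≤+ (subst (_≤ + n) (staircaseRank-triangular h) bound))
    (Signed.∣ᵤ⇒∣ 2∣j+n) (staircaseRank+triangular-even h)

  from : t ≤₂ n → RankCondition n j
  from (e , refl) =
    Signed.∣⇒∣ᵤ (subst (+ 2 Signed.∣_)
      (trans (ℤₚ.+-assoc j (+ t) (+ (e ℕ.* 2))) (cong (_+_ j) (sym (ℤₚ.pos-+ t (e ℕ.* 2)))))
      (Signed.∣m∣n⇒∣m+n (staircaseRank+triangular-even h)
                        (Signed.divides (+ e) (ℤₚ.pos-* e 2)))) ,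
    subst (_≤ + (t ℕ.+ e ℕ.* 2)) (sym (staircaseRank-triangular h)) (+≤+ (≤₂⇒≤ (e , refl)))

staircaseIndex : ℤ → ℕ
staircaseIndex (+ zero) = 0
staircaseIndex (+ suc m) = suc (m ℕ.* 2)
staircaseIndex -[1+ m ] = suc m ℕ.* 2

staircaseRank-staircaseIndex : ∀ j → staircaseRank (staircaseIndex j) ≡ j
staircaseRank-staircaseIndex (+ zero) = refl
staircaseRank-staircaseIndex (+ suc m) = staircaseRank-odd m
staircaseRank-staircaseIndex -[1+ m ] = staircaseRank-even (suc m)

corollary1 : (n : ℕ) (j : ℤ) →
    (Σ (List ℕ) (λ p → IsPartition n p × bgRank p ≡ j))
      ⇔ ((+ 2 ∣ j + + n) × (j * (+ 2 * j - + 1) ≤ + n))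
corollary1 n j = mk⇔ to from
  where
  open ≡-Reasoning
  h = staircaseIndex j

  to : Σ (List ℕ) (λ p → IsPartition n p × bgRank p ≡ j) → RankCondition n j
  to (L , (sorted , _ , sum≡n) , rank≡j) =
    subst (RankCondition n) (trans (sym (bgRank≡staircaseRank-coreIndex L)) rank≡j)
      (Equivalence.from (rankCondition⇔triangular≤₂ (coreIndex L) n)
        (subst (triangular (coreIndex L) ≤₂_) sum≡n (triangular-coreIndex≤₂sum L sorted)))

  from : RankCondition n j → Σ (List ℕ) (λ p → IsPartition n p × bgRank p ≡ j)
  from cond with L , partition , coreIndex≡h ← partitionWithCoreIndex h
                   (Equivalence.to (rankCondition⇔triangular≤₂ h n)
                     (subst (RankCondition n) (sym (staircaseRank-staircaseIndex j)) cond))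
    = L , partition , (begin
        bgRank L                     ≡⟨ bgRank≡staircaseRank-coreIndex L ⟩
        staircaseRank (coreIndex L)  ≡⟨ cong staircaseRank coreIndex≡h ⟩
        staircaseRank h              ≡⟨ staircaseRank-staircaseIndex j ⟩
        j                            ∎)
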